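{- Let $k>1$ be an integer and let $A$ be a generalized Cartan matrix. If $A$ is not of type $N_m$ for any $m<k$, and every proper indecomposable (connected) principal submatrix of $A$ is of type $N_{m'}$ for some integer $m'$ with $0\le m'<k$, then $A$ is of type $N_k$.
   Context: A generalized Cartan matrix (GCM) is an $\ell\times\ell$ integer matrix $A=(a_{ij})$ with $a_{ii}=2$, $a_{ij}\le 0$ for $i\neq j$, and $a_{ij}=0$ if and only if $a_{ji}=0$; its dimension is $\ell$. A principal submatrix is obtained by deleting some rows and the columns with the same indices. $A$ is indecomposable if it cannot be brought, by a simultaneous permutation of rows and columns, to block-diagonal form $\mathrm{diag}(A_1,A_2)$ with $A_1,A_2$ GCMs; it is symmetrizable if $DA$ is symmetric for some invertible diagonal rational matrix $D$. Throughout, GCMs are assumed symmetrizable and indecomposable. Vector inequalities are entrywise. An indecomposable GCM is of finite type if $\det A\neq0$, there is $u>0$ with $Au>0$, and $Au\ge0$ implies $u>0$ or $u=0$; of affine type if $\operatorname{corank}A=1$, there is $u>0$ with $Au=0$, and $Au\ge0$ implies $Au=0$; of indefinite type if there is $u>0$ with $Au<0$, and $Au\ge0$, $u\ge0$ imply $u=0$. It is hyperbolic if it is neither finite nor affine but every proper indecomposable principal submatrix is finite or affine. Type $N_0$ = finite, $N_1$ = affine, $N_2$ = hyperbolic; for $k\ge3$, a GCM is of type $N_k$ if it contains at least one principal submatrix of type $N_{k-1}$ and every other (indecomposable) principal submatrix is of type $N_m$ for some $m<k$.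
   Formalization: The test vectors u in the definitions of finite and affine type, and the null-space vectors defining corank 1, have rational entries. -}

module Defs where

open import Data.Nat as ℕ using (ℕ; zero; suc)
open import Data.Integer as ℤ using (ℤ; +_)
open import Data.Rational as ℚ using (ℚ; 0ℚ; _/_)
open import Data.Fin as Fin using (Fin; punchIn; toℕ)
open import Data.Bool using (Bool; true; false)
open import Data.Product using (Σ; ∃; _×_; _,_)
open import Data.Sum using (_⊎_)
open import Relation.Nullary using (¬_)
open import Relation.Binary.PropositionalEquality using (_≡_; _≢_)

Mat : ℕ → Set
Mat n = Fin n → Fin n → ℤ

QVec : ℕ → Set
QVec n = Fin n → ℚ

toℚ : ℤ → ℚ
toℚ a = a / 1

sumℤ : ∀ n → (Fin n → ℤ) → ℤ
sumℤ zero    f = + 0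
sumℤ (suc n) f = f Fin.zero ℤ.+ sumℤ n (λ i → f (Fin.suc i))

sumℚ : ∀ n → (Fin n → ℚ) → ℚ
sumℚ zero    f = 0ℚ
sumℚ (suc n) f = f Fin.zero ℚ.+ sumℚ n (λ i → f (Fin.suc i))

det : ∀ n → Mat n → ℤ
det zero    A = + 1
det (suc n) A =
  sumℤ (suc n) (λ j → (ℤ.- (+ 1)) ℤ.^ toℕ j ℤ.* A Fin.zero j
                        ℤ.* det n (λ r c → A (Fin.suc r) (punchIn j c)))

IsGCM : ∀ {n} → Mat n → Set
IsGCM {n} A =
  (∀ i → A i i ≡ + 2) ×
  (∀ i j → i ≢ j → A i j ℤ.≤ + 0) ×
  (∀ i j → A i j ≡ + 0 → A j i ≡ + 0)

-- symmetrizable: DA symmetric for an invertible diagonal rational D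
Symmetrizable : ∀ {n} → Mat n → Set
Symmetrizable {n} A =
  Σ (QVec n) λ d → (∀ i → d i ≢ 0ℚ) ×
    (∀ i j → d i ℚ.* toℚ (A i j) ≡ d j ℚ.* toℚ (A j i))

-- indecomposable: no simultaneous permutation to block-diagonal form
-- diag(A₁ , A₂) with A₁, A₂ nonempty, i.e. no partition of the index set
-- into two nonempty parts S, T with a_ij = a_ji = 0 for i ∈ S, j ∈ T
Indecomposable : ∀ {n} → Mat n → Set
Indecomposable {n} A =
  ¬ (Σ (Fin n → Bool) λ S →
       (∃ λ i → S i ≡ true) × (∃ λ j → S j ≡ false) ×
       (∀ i j → S i ≡ true → S j ≡ false → (A i j ≡ + 0) × (A j i ≡ + 0)))

_·_ : ∀ {n} → Mat n → QVec n → QVec n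
_·_ {n} A u i = sumℚ n (λ j → toℚ (A i j) ℚ.* u j)

Pos : ∀ {n} → QVec n → Set
Pos u = ∀ i → 0ℚ ℚ.< u i

NonNeg : ∀ {n} → QVec n → Set
NonNeg u = ∀ i → 0ℚ ℚ.≤ u i

Zero : ∀ {n} → QVec n → Set
Zero u = ∀ i → u i ≡ 0ℚ

Corank1 : ∀ {n} → Mat n → Set
Corank1 {n} A =
  (Σ (QVec n) λ v → ¬ Zero v × Zero (A · v)) ×
  (∀ v w → ¬ Zero v → Zero (A · v) → Zero (A · w) →
     Σ ℚ λ c → ∀ i → w i ≡ c ℚ.* v i)

Finite : ∀ {n} → Mat n → Set
Finite {n} A =
  det n A ≢ + 0 ×
  (Σ (QVec n) λ u → Pos u × Pos (A · u)) ×
  (∀ u → NonNeg (A · u) → Pos u ⊎ Zero u)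

Affine : ∀ {n} → Mat n → Set
Affine {n} A =
  Corank1 A ×
  (Σ (QVec n) λ u → Pos u × Zero (A · u)) ×
  (∀ u → NonNeg (A · u) → Zero (A · u))

StrictInc : ∀ {p n} → (Fin p → Fin n) → Set
StrictInc f = ∀ i j → i Fin.< j → f i Fin.< f j

sub : ∀ {n p} → Mat n → (Fin p → Fin n) → Mat p
sub A f i j = A (f i) (f j)

ProperIndecSub : ∀ {n} → Mat n → ∀ p → (Fin p → Fin n) → Set
ProperIndecSub {n} A p f =
  StrictInc f × 1 ℕ.≤ p × p ℕ.< n × Indecomposable (sub A f)

Hyperbolic : ∀ {n} → Mat n → Set
Hyperbolic {n} A =
  ¬ Finite A × ¬ Affine A ×
  (∀ p f → ProperIndecSub A p f → Finite (sub A f) ⊎ Affine (sub A f))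

data IsN : ℕ → ∀ {n} → Mat n → Set where
  N0 : ∀ {n} {A : Mat n} → Finite A → IsN 0 A
  N1 : ∀ {n} {A : Mat n} → Affine A → IsN 1 A
  N2 : ∀ {n} {A : Mat n} → Hyperbolic A → IsN 2 A
  Nk : ∀ k {n} {A : Mat n} →
       (Σ ℕ λ p → Σ (Fin p → Fin n) λ f →
          ProperIndecSub A p f × IsN (suc (suc k)) (sub A f)) →
       (∀ p f → ProperIndecSub A p f →
          Σ ℕ λ m → m ℕ.< suc (suc (suc k)) × IsN m (sub A f)) →
       IsN (suc (suc (suc k))) A

-- For k = 2 the hypotheses are literally those of hyperbolicity. For k > 2,
-- since there are finitely many principal submatrices, either one of them
-- has type N_{k-1}, which is what N_k asks for, or all of them have type
-- below k-1, and then by induction A would be of type N_{k-1}, which is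
-- excluded.
-- Constructively this case split is a finite search over index vectors,
-- which is why indecomposability has to be decidable and the types N_m
-- invariant under pointwise equality of matrices.
module Submission where

open import Defs
open import Data.Nat using (ℕ; _<_; _≤_)
open import Data.Fin using (Fin)
open import Data.Product using (Σ; _×_)
open import Relation.Nullary using (¬_)

open import Data.Nat using (zero; suc; s≤s; z≤n)
open import Data.Nat.Properties using (_≟_; _≤?_; _<?_; ≤-refl; ≤-pred; ≤∧≢⇒<; m≤n⇒m≤1+n; anyUpTo?)
open import Data.Integer as ℤ using (ℤ; +_)
open import Data.Rational as ℚ using (ℚ; 0ℚ)
open import Data.Fin as Fin using (punchIn; toℕ)
open import Data.Fin.Properties using (any?; all?) renaming (_<?_ to _<ᶠ?_)
open import Data.Fin.Subset.Properties using (anySubset?)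
open import Data.Bool using (Bool; true; false)
open import Data.Bool.Properties as Bool using ()
open import Data.Vec using (Vec; []; _∷_; lookup; tabulate)
open import Data.Vec.Properties using (lookup∘tabulate)
open import Data.Product using (∃; _,_; proj₁; proj₂)
open import Data.Sum as Sum using (_⊎_; inj₁; inj₂; [_,_]′)
open import Data.Empty using (⊥-elim)
open import Function using (_∘_)
open import Relation.Unary using (Pred; Decidable)
open import Relation.Nullary using (Dec; yes; no; ¬?; _×-dec_; _→-dec_; map′; recompute)
open import Relation.Binary.PropositionalEquality using (_≡_; refl; sym; trans; cong; cong₂; subst; subst₂)

_≈ᴹ_ : ∀ {n} → Mat n → Mat n → Set
A ≈ᴹ B = ∀ i j → A i j ≡ B i j

≈ᴹ-sym : ∀ {n} {A B : Mat n} → A ≈ᴹ B → B ≈ᴹ A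
≈ᴹ-sym e i j = sym (e i j)

sub-resp : ∀ {n p} {A B : Mat n} (f : Fin p → Fin n) → A ≈ᴹ B → sub A f ≈ᴹ sub B f
sub-resp f e i j = e (f i) (f j)

sumℤ-cong : ∀ n {f g : Fin n → ℤ} → (∀ i → f i ≡ g i) → sumℤ n f ≡ sumℤ n g
sumℤ-cong zero    e = refl
sumℤ-cong (suc n) e = cong₂ ℤ._+_ (e Fin.zero) (sumℤ-cong n (e ∘ Fin.suc))

sumℚ-cong : ∀ n {f g : Fin n → ℚ} → (∀ i → f i ≡ g i) → sumℚ n f ≡ sumℚ n g
sumℚ-cong zero    e = refl
sumℚ-cong (suc n) e = cong₂ ℚ._+_ (e Fin.zero) (sumℚ-cong n (e ∘ Fin.suc))

det-resp : ∀ n {A B : Mat n} → A ≈ᴹ B → det n A ≡ det n B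
det-resp zero    e = refl
det-resp (suc n) e = sumℤ-cong (suc n) λ j →
  cong₂ (λ a d → (ℤ.- (+ 1)) ℤ.^ toℕ j ℤ.* a ℤ.* d)
        (e Fin.zero j) (det-resp n (λ r c → e (Fin.suc r) (punchIn j c)))

·-resp : ∀ {n} {A B : Mat n} → A ≈ᴹ B → ∀ u i → (A · u) i ≡ (B · u) i
·-resp {n} e u i = sumℚ-cong n λ j → cong (λ a → toℚ a ℚ.* u j) (e i j)

Zero-·-resp : ∀ {n} {A B : Mat n} → A ≈ᴹ B → ∀ u → Zero (A · u) → Zero (B · u)
Zero-·-resp e u z i = trans (sym (·-resp e u i)) (z i)

NonNeg-·-resp : ∀ {n} {A B : Mat n} → A ≈ᴹ B → ∀ u → NonNeg (A · u) → NonNeg (B · u)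
NonNeg-·-resp e u nn i = subst (0ℚ ℚ.≤_) (·-resp e u i) (nn i)

Finite-resp : ∀ {n} {A B : Mat n} → A ≈ᴹ B → Finite A → Finite B
Finite-resp {n} e (det≢0 , (u , u>0 , Au>0) , Au≥0⇒u>0∨u≡0) =
  (det≢0 ∘ trans (det-resp n e)) ,
  (u , u>0 , λ i → subst (0ℚ ℚ.<_) (·-resp e u i) (Au>0 i)) ,
  λ v → Au≥0⇒u>0∨u≡0 v ∘ NonNeg-·-resp (≈ᴹ-sym e) v

Affine-resp : ∀ {n} {A B : Mat n} → A ≈ᴹ B → Affine A → Affine B
Affine-resp e (((v , v≢0 , Av≡0) , unique) , (u , u>0 , Au≡0) , Au≥0⇒Au≡0) =
  ((v , v≢0 , Zero-·-resp e v Av≡0) ,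
   λ v w v≢0 Bv≡0 Bw≡0 →
     unique v w v≢0 (Zero-·-resp (≈ᴹ-sym e) v Bv≡0) (Zero-·-resp (≈ᴹ-sym e) w Bw≡0)) ,
  (u , u>0 , Zero-·-resp e u Au≡0) ,
  λ w → Zero-·-resp e w ∘ Au≥0⇒Au≡0 w ∘ NonNeg-·-resp (≈ᴹ-sym e) w

Splitting : ∀ {n} → Mat n → Pred (Fin n → Bool) _
Splitting A S =
  (∃ λ i → S i ≡ true) × (∃ λ j → S j ≡ false) ×
  (∀ i j → S i ≡ true → S j ≡ false → (A i j ≡ + 0) × (A j i ≡ + 0))

Splitting-resp : ∀ {n} {A B : Mat n} {S T : Fin n → Bool} →
  A ≈ᴹ B → (∀ i → S i ≡ T i) → Splitting A S → Splitting B T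
Splitting-resp e s≡t ((i , Si) , (j , Sj) , zeros) =
  (i , trans (sym (s≡t i)) Si) , (j , trans (sym (s≡t j)) Sj) ,
  λ i j Ti Tj → let (Aij , Aji) = zeros i j (trans (s≡t i) Ti) (trans (s≡t j) Tj)
                in trans (sym (e i j)) Aij , trans (sym (e j i)) Aji

Indecomposable-resp : ∀ {n} {A B : Mat n} → A ≈ᴹ B → Indecomposable A → Indecomposable B
Indecomposable-resp e indec (S , split) = indec (S , Splitting-resp (≈ᴹ-sym e) (λ _ → refl) split)

ProperIndecSub-resp : ∀ {n p} {A B : Mat n} {f g : Fin p → Fin n} →
  A ≈ᴹ B → (∀ i → f i ≡ g i) → ProperIndecSub A p f → ProperIndecSub B p g
ProperIndecSub-resp {B = B} e f≡g (inc , p≥1 , p<n , indec) =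
  (λ i j i<j → subst₂ Fin._<_ (f≡g i) (f≡g j) (inc i j i<j)) , p≥1 , p<n ,
  Indecomposable-resp (λ i j → trans (e _ _) (cong₂ B (f≡g i) (f≡g j))) indec

Hyperbolic-resp : ∀ {n} {A B : Mat n} → A ≈ᴹ B → Hyperbolic A → Hyperbolic B
Hyperbolic-resp e (¬fin , ¬aff , subs) =
  ¬fin ∘ Finite-resp (≈ᴹ-sym e) , ¬aff ∘ Affine-resp (≈ᴹ-sym e) ,
  λ p f pr → Sum.map (Finite-resp (sub-resp f e)) (Affine-resp (sub-resp f e))
                     (subs p f (ProperIndecSub-resp (≈ᴹ-sym e) (λ _ → refl) pr))

IsN-resp : ∀ {m n} {A B : Mat n} → A ≈ᴹ B → IsN m A → IsN m B
IsN-resp e (N0 fin) = N0 (Finite-resp e fin)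
IsN-resp e (N1 aff) = N1 (Affine-resp e aff)
IsN-resp e (N2 hyp) = N2 (Hyperbolic-resp e hyp)
IsN-resp e (Nk k (p , f , pr , isN) subs) =
  Nk k (p , f , ProperIndecSub-resp e (λ _ → refl) pr , IsN-resp (sub-resp f e) isN)
    λ p f pr → let (m , m<k , isN) = subs p f (ProperIndecSub-resp (≈ᴹ-sym e) (λ _ → refl) pr)
               in m , m<k , IsN-resp (sub-resp f e) isN

splitting? : ∀ {n} (A : Mat n) → Decidable (Splitting A)
splitting? A S =
  any? (λ i → S i Bool.≟ true) ×-dec any? (λ j → S j Bool.≟ false) ×-dec
  all? λ i → all? λ j → (S i Bool.≟ true) →-dec (S j Bool.≟ false) →-dec
    (A i j ℤ.≟ + 0 ×-dec A j i ℤ.≟ + 0)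

indecomposable? : ∀ {n} (A : Mat n) → Dec (Indecomposable A)
indecomposable? A = ¬? (map′ (λ (s , split) → lookup s , split)
  (λ (S , split) → tabulate S , Splitting-resp (λ _ _ → refl) (sym ∘ lookup∘tabulate S) split)
  (anySubset? (splitting? A ∘ lookup)))

strictInc? : ∀ {p n} (f : Fin p → Fin n) → Dec (StrictInc f)
strictInc? f = all? λ i → all? λ j → (i <ᶠ? j) →-dec (f i <ᶠ? f j)

properIndecSub? : ∀ {n} (A : Mat n) p f → Dec (ProperIndecSub A p f)
properIndecSub? {n} A p f = strictInc? f ×-dec (1 ≤? p) ×-dec (p <? n) ×-dec indecomposable? (sub A f)

Searchable : Set → Set₁
Searchable X = ∀ {P : Pred X _} → Decidable P → Dec (∃ P)

anyVec? : ∀ {X} → Searchable X → ∀ p → Searchable (Vec X p)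
anyVec? any-X? zero    P? = map′ ([] ,_) (λ { ([] , P[]) → P[] }) (P? [])
anyVec? any-X? (suc p) P? =
  map′ (λ (x , v , Pxv) → x ∷ v , Pxv) (λ { (x ∷ v , Pxv) → x , v , Pxv })
       (any-X? λ x → anyVec? any-X? p (P? ∘ (x ∷_)))

SubtypesBelow : ℕ → ∀ {n} → Mat n → Set
SubtypesBelow k {n} A =
  ∀ p (f : Fin p → Fin n) → ProperIndecSub A p f → Σ ℕ λ m → m < k × IsN m (sub A f)

SubOfType : ℕ → ∀ {n} → Mat n → Set
SubOfType m {n} A = Σ ℕ λ p → Σ (Fin p → Fin n) λ f → ProperIndecSub A p f × IsN m (sub A f)

module _ {n m} (A : Mat n) (below : SubtypesBelow (suc m) A) where

  -- Feeding `below` only recomputed proofs makes the type it assigns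
  -- independent of the proof of properness, so that "has type m" is decidable.
  typeOf : ∀ p f → .(ProperIndecSub A p f) → Σ ℕ λ t → t < suc m × IsN t (sub A f)
  typeOf p f pr = below p f (recompute (properIndecSub? A p f) pr)

  SelectsSubOfType : ∀ p → Pred (Vec (Fin n) p) _
  SelectsSubOfType p v = Σ (ProperIndecSub A p (lookup v)) λ pr → proj₁ (typeOf p (lookup v) pr) ≡ m

  selectsSubOfType? : ∀ p → Decidable (SelectsSubOfType p)
  selectsSubOfType? p v with properIndecSub? A p (lookup v)
  ... | no ¬pr = no (¬pr ∘ proj₁)
  ... | yes pr = map′ (pr ,_) proj₂ (proj₁ (typeOf p (lookup v) pr) ≟ m)

  subOfType⊎subtypesBelow : SubOfType m A ⊎ SubtypesBelow m A
  subOfType⊎subtypesBelow with anyUpTo? (λ p → anyVec? any? p (selectsSubOfType? p)) n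
  ... | yes (p , _ , v , pr , t≡m) =
    inj₁ (p , lookup v , pr , subst (λ t → IsN t _) t≡m (proj₂ (proj₂ (typeOf p (lookup v) pr))))
  ... | no none = inj₂ λ p f pr →
    let f≗v = sym ∘ lookup∘tabulate f
        prᵥ : ProperIndecSub A p (lookup (tabulate f))
        prᵥ = ProperIndecSub-resp {A = A} (λ _ _ → refl) f≗v pr
        (t , t≤m , isN) = typeOf p (lookup (tabulate f)) prᵥ
        t≢m = λ t≡m → none (p , proj₁ (proj₂ (proj₂ pr)) , tabulate f , prᵥ , t≡m)
    in t , ≤∧≢⇒< (≤-pred t≤m) t≢m ,
       IsN-resp (λ i j → cong₂ A (sym (f≗v i)) (sym (f≗v j))) isN

finite⊎affine : ∀ {n} {A : Mat n} → (Σ ℕ λ m → m < 2 × IsN m A) → Finite A ⊎ Affine A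
finite⊎affine (0 , _ , N0 fin) = inj₁ fin
finite⊎affine (1 , _ , N1 aff) = inj₂ aff
finite⊎affine (suc (suc _) , s≤s (s≤s ()) , _)

IsN-ofSubtypesBelow : ∀ k → 1 < k → ∀ {n} (A : Mat n) →
  (∀ m → m < k → ¬ IsN m A) → SubtypesBelow k A → IsN k A
IsN-ofSubtypesBelow 1 (s≤s ()) A
IsN-ofSubtypesBelow 2 _ A ¬lower below =
  N2 (¬lower 0 (s≤s z≤n) ∘ N0 , ¬lower 1 ≤-refl ∘ N1 , λ p f → finite⊎affine ∘ below p f)
IsN-ofSubtypesBelow (suc (suc (suc k))) _ A ¬lower below =
  [ (λ sub → Nk k sub below) , (λ below′ → ⊥-elim (¬lower (suc (suc k)) ≤-refl
      (IsN-ofSubtypesBelow (suc (suc k)) (s≤s (s≤s z≤n)) A (λ m → ¬lower m ∘ m≤n⇒m≤1+n) below′))) ]′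
  (subOfType⊎subtypesBelow A below)

corollary2p4 : (k : ℕ) → 1 < k →
    ∀ {n} (A : Mat n) → 1 ≤ n →
    IsGCM A → Symmetrizable A → Indecomposable A →
    (∀ m → m < k → ¬ IsN m A) →
    (∀ p (f : Fin p → Fin n) → ProperIndecSub A p f →
       Σ ℕ λ m → m < k × IsN m (sub A f)) →
    IsN k A
corollary2p4 k 1<k A _ _ _ _ = IsN-ofSubtypesBelow k 1<k A
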